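{- Let $\Gamma$ be a finite simple vertex-transitive graph on $n$ vertices, and let $s$ be the order of the stabilizer of a vertex in $\mathrm{Aut}(\Gamma)$. Then (a) $\Gamma$ is $s$-uniformly vertex-transitive; (b) for $1\le k\le s-1$, $\Gamma$ is $k$-uniformly vertex-transitive if and only if $\Gamma$ is $(s-k)$-uniformly vertex-transitive.
   Context: Automorphisms are identified with $n\times n$ permutation matrices (entry $(u,v)$ is $1$ iff $\sigma(u)=v$); $J_n$ is the all-ones matrix. For an integer $k\ge1$, $\Gamma$ is $k$-uniformly vertex-transitive if there is a subset $\{\sigma_1,\ldots,\sigma_{kn}\}\subset\mathrm{Aut}(\Gamma)$ of size $kn$ with $\sum_i\sigma_i=kJ_n$. A graph is vertex-transitive if $\mathrm{Aut}(\Gamma)$ acts transitively on its vertices. -}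

module Defs where

open import Data.Nat using (ℕ; _*_; _≤_; _∸_)
open import Data.Bool using (Bool)
open import Data.Fin using (Fin)
open import Data.Vec using (Vec; lookup)
open import Data.List using (List; length; filter)
open import Data.List.Relation.Unary.Unique.Propositional using (Unique)
open import Data.List.Relation.Unary.All using (All)
open import Data.List.Membership.Propositional using (_∈_)
open import Data.Fin using (_≟_)
open import Data.Product using (_×_; ∃-syntax)
open import Function.Definitions using (Injective)
open import Relation.Binary.PropositionalEquality using (_≡_)

record SimpleGraph (n : ℕ) : Set where
  field
    adj     : Fin n → Fin n → Bool
    symm    : ∀ u v → adj u v ≡ adj v u
    irrefl  : ∀ u → adj u u ≡ Data.Bool.false

open SimpleGraph public

-- A map Fin n → Fin n stored as its table (σ(u) = lookup σ u), so that
-- equality of maps is propositional equality of tables.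
Map : ℕ → Set
Map n = Vec (Fin n) n

app : ∀ {n} → Map n → Fin n → Fin n
app σ u = lookup σ u

-- σ is an automorphism: a permutation of the vertices preserving adjacency
-- (injective on a finite set, hence bijective).
IsAut : ∀ {n} → SimpleGraph n → Map n → Set
IsAut {n} Γ σ =
  Injective _≡_ _≡_ (app σ) × (∀ u v → adj Γ (app σ u) (app σ v) ≡ adj Γ u v)

VertexTransitive : ∀ {n} → SimpleGraph n → Set
VertexTransitive {n} Γ = ∀ u v → ∃[ σ ] (IsAut Γ σ × app σ u ≡ v)

StabilizerOrder : ∀ {n} → SimpleGraph n → Fin n → ℕ → Set
StabilizerOrder {n} Γ v s = ∃[ L ]
  ( Unique L
  × (∀ σ → σ ∈ L → (IsAut Γ σ × app σ v ≡ v))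
  × (∀ σ → IsAut Γ σ → app σ v ≡ v → σ ∈ L)
  × length {A = Map n} L ≡ s )

-- Number of maps σ in a list with σ(u) = v, i.e. the (u,v) entry of the sum
-- of the corresponding permutation matrices.
entry : ∀ {n} → List (Map n) → Fin n → Fin n → ℕ
entry L u v = length (filter (λ σ → app σ u ≟ v) L)

-- k-uniformly vertex-transitive: a set {σ_1,…,σ_{kn}} ⊆ Aut(Γ) of size kn
-- (a duplicate-free list) whose permutation matrices sum to k J_n.
UniformlyVT : ∀ {n} → SimpleGraph n → ℕ → Set
UniformlyVT {n} Γ k = ∃[ L ]
  ( Unique L
  × All (IsAut Γ) L
  × length {A = Map n} L ≡ k * n
  × (∀ u v → entry L u v ≡ k) )

module Submission where

-- Let Aut be the (finite) list of all automorphisms of Γ and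
-- write N(X; u ↦ w) for the number of maps in X sending u to w, i.e. the
-- (u,w) entry of the sum of the permutation matrices of X.
--   * Left multiplication by an automorphism γ with γ w = w' injects the
--     automorphisms sending u to w into those sending u to w'; by vertex
--     transitivity every row of the matrix sum of Aut is therefore constant.
--   * Each map contributes 1 to each row, so every row sums to |Aut|; with
--     constant rows this makes all entries equal, and N(Aut; v ↦ v) = s is
--     the order of the stabiliser of v.  Hence Aut itself witnesses
--     s-uniformity (part (a)), with |Aut| = s n.
--   * If L ⊆ Aut witnesses k-uniformity, the complement Aut ∖ L has entries
--     s - k and size s n - k n, so it witnesses (s-k)-uniformity; applying
--     this twice gives the equivalence of part (b).

open import Defs
open import Data.Nat using (ℕ; zero; suc; _+_; _*_; _≤_; _∸_)
import Data.Nat.Properties as ℕ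
open import Data.Fin as Fin using (Fin; punchIn)
open import Data.Fin.Properties using (all?; punchInᵢ≢i)
open import Data.Bool using (if_then_else_)
import Data.Bool as Bool
open import Data.Vec using (Vec; []; _∷_; lookup; tabulate)
open import Data.Vec.Properties using (lookup∘tabulate; tabulate∘lookup; tabulate-cong; ≡-dec)
open import Data.List using (List; []; _∷_; length; filter; map; _++_; deduplicate; allFin; cartesianProduct)
open import Data.List.Properties using (length-++; length-map)
open import Data.List.Relation.Unary.Unique.Propositional using (Unique)
import Data.List.Relation.Unary.Unique.Propositional.Properties as Unique
open import Data.List.Relation.Unary.Unique.DecPropositional.Properties using (deduplicate-!)
import Data.List.Relation.Unary.All as All
open import Data.List.Relation.Unary.Any using (here)
open import Data.List.Membership.Propositional using (_∈_; _∉_)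
open import Data.List.Membership.Propositional.Properties
  using (∈-++⁺ˡ; ∈-++⁺ʳ; ∈-++⁻; ∈-filter⁺; ∈-filter⁻; ∈-map⁺; ∈-map⁻;
         ∈-deduplicate⁺; ∈-deduplicate⁻; ∈-cartesianProduct⁺; ∈-allFin)
import Data.List.Membership.DecPropositional as DecMembership
open import Data.List.Membership.Propositional.Properties.WithK using (unique∧set⇒bag)
open import Data.List.Relation.Binary.BagAndSetEquality using (∼bag⇒↭)
open import Data.List.Relation.Binary.Permutation.Propositional.Properties using (↭-length)
open import Data.List.Relation.Binary.Subset.Propositional using (_⊆_)
open import Data.Product using (_×_; _,_; proj₁; proj₂)
open import Data.Sum using (_⊎_; inj₁; inj₂; [_,_])
open import Data.Empty using (⊥)
open import Function.Bundles using (_⇔_; mk⇔)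
open import Function.Definitions using (Injective)
open import Relation.Nullary using (Dec; yes; no; does)
open import Relation.Nullary.Decidable using (map′; _→-dec_; _×-dec_; ¬?; dec-true; dec-false)
open import Relation.Unary using (Decidable)
open import Relation.Binary.Definitions using (DecidableEquality)
open import Relation.Binary.PropositionalEquality
  using (_≡_; refl; sym; trans; cong; cong₂; subst; module ≡-Reasoning)
open import Algebra.Properties.CommutativeMonoid.Sum ℕ.+-0-commutativeMonoid
  using (sum; sum-cong-≗; ∑-distrib-+; sum-remove; sum-replicate-zero)

module Counting {A : Set} where

  length-≐ : {X Y : List A} → Unique X → Unique Y →
             (∀ {x} → x ∈ X → x ∈ Y) → (∀ {x} → x ∈ Y → x ∈ X) →
             length X ≡ length Y
  length-≐ uX uY X⊆Y Y⊆X = ↭-length (∼bag⇒↭ (unique∧set⇒bag uX uY (mk⇔ X⊆Y Y⊆X)))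

  record Partition (X Y Z : List A) : Set where
    field
      disjoint : ∀ {x} → x ∈ Y → x ∈ Z → ⊥
      split    : ∀ {x} → x ∈ X → x ∈ Y ⊎ x ∈ Z
      join     : ∀ {x} → x ∈ Y ⊎ x ∈ Z → x ∈ X

  length-partition : {X Y Z : List A} → Unique X → Unique Y → Unique Z →
                     Partition X Y Z → length X ≡ length Y + length Z
  length-partition {X} {Y} {Z} uX uY uZ P = begin
      length X        ≡⟨ length-≐ uX uYZ (λ x∈ → [ ∈-++⁺ˡ , ∈-++⁺ʳ Y ] (split x∈))
                                         (λ x∈ → join (∈-++⁻ Y x∈)) ⟩
      length (Y ++ Z) ≡⟨ length-++ Y ⟩
      length Y + length Z ∎
    where
    open ≡-Reasoning
    open Partition P
    uYZ : Unique (Y ++ Z)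
    uYZ = Unique.++⁺ uY uZ (λ (y , z) → disjoint y z)

  filter-partition : ∀ {p} {P : A → Set p} (P? : Decidable P) {X Y Z : List A} →
                     Partition X Y Z → Partition (filter P? X) (filter P? Y) (filter P? Z)
  filter-partition P? {X} {Y} {Z} XYZ = record
    { disjoint = λ y z → disjoint (proj₁ (∈-filter⁻ P? {xs = Y} y)) (proj₁ (∈-filter⁻ P? {xs = Z} z))
    ; split    = λ x∈ → let (x∈X , px) = ∈-filter⁻ P? {xs = X} x∈ in
                        [ (λ y → inj₁ (∈-filter⁺ P? y px)) , (λ z → inj₂ (∈-filter⁺ P? z px)) ] (split x∈X)
    ; join     = [ (λ y → let (y∈ , py) = ∈-filter⁻ P? {xs = Y} y in ∈-filter⁺ P? (join (inj₁ y∈)) py)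
                 , (λ z → let (z∈ , pz) = ∈-filter⁻ P? {xs = Z} z in ∈-filter⁺ P? (join (inj₂ z∈)) pz) ]
    }
    where open Partition XYZ

  module WithDecidableEquality (_≟_ : DecidableEquality A) where
    open DecMembership _≟_ using (_∈?_)

    _∖_ : List A → List A → List A
    X ∖ Y = filter (λ x → ¬? (x ∈? Y)) X

    ∖-unique : {X : List A} (Y : List A) → Unique X → Unique (X ∖ Y)
    ∖-unique Y uX = Unique.filter⁺ (λ x → ¬? (x ∈? Y)) uX

    ∖-partition : {X Y : List A} → Y ⊆ X → Partition X Y (X ∖ Y)
    ∖-partition {X} {Y} Y⊆X = record
      { disjoint = λ y z → proj₂ (∈-filter⁻ notY? {xs = X} z) y
      ; split    = λ {x} x∈ → choose x∈ (x ∈? Y)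
      ; join     = [ Y⊆X , (λ z → proj₁ (∈-filter⁻ notY? {xs = X} z)) ]
      }
      where
      notY? : Decidable (_∉ Y)
      notY? x = ¬? (x ∈? Y)
      choose : ∀ {x} → x ∈ X → Dec (x ∈ Y) → x ∈ Y ⊎ x ∈ X ∖ Y
      choose x∈ (yes y) = inj₁ y
      choose x∈ (no ¬y) = inj₂ (∈-filter⁺ notY? x∈ ¬y)

    length-⊆ : {X Y : List A} → Unique X → Unique Y → Y ⊆ X → length Y ≤ length X
    length-⊆ {X} {Y} uX uY Y⊆X =
      subst (length Y ≤_)
            (sym (length-partition uX uY (∖-unique Y uX) (∖-partition Y⊆X)))
            (ℕ.m≤m+n (length Y) _)

    length-injection : {X Y : List A} (f : A → A) → (∀ {x y} → f x ≡ f y → x ≡ y) →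
                       Unique X → Unique Y → (∀ {x} → x ∈ X → f x ∈ Y) →
                       length X ≤ length Y
    length-injection {X} {Y} f f-inj uX uY f-into =
      subst (_≤ length Y) (length-map f X)
            (length-⊆ uY (Unique.map⁺ f-inj uX) image⊆Y)
      where
      image⊆Y : map f X ⊆ Y
      image⊆Y y∈ with ∈-map⁻ f y∈
      ... | x , x∈ , refl = f-into x∈

open Counting

-- Row sums of permutation matrices: every map contributes exactly 1 to each
-- row, so each row of the matrix sum of X adds up to |X|.

δ : ∀ {m} → Fin m → Fin m → ℕ
δ a w = if does (a Fin.≟ w) then 1 else 0

sum-δ : ∀ {m} (a : Fin m) → sum (δ a) ≡ 1
sum-δ {suc m} a = begin
    sum (δ a)                             ≡⟨ sum-remove {i = a} (δ a) ⟩
    δ a a + sum (λ j → δ a (punchIn a j)) ≡⟨ cong₂ _+_ diagonal (sum-cong-≗ off-diagonal) ⟩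
    1 + sum {m} (λ _ → 0)                 ≡⟨ cong (1 +_) (sum-replicate-zero m) ⟩
    1                                     ∎
  where
  open ≡-Reasoning
  diagonal : δ a a ≡ 1
  diagonal = cong (if_then 1 else 0) (dec-true (a Fin.≟ a) refl)
  off-diagonal : ∀ j → δ a (punchIn a j) ≡ 0
  off-diagonal j = cong (if_then 1 else 0) (dec-false (a Fin.≟ punchIn a j) (λ e → punchInᵢ≢i a j (sym e)))

sum-const : ∀ m c → sum {m} (λ _ → c) ≡ m * c
sum-const zero    c = refl
sum-const (suc m) c = cong (c +_) (sum-const m c)

module _ {n : ℕ} where

  entry-∷ : (σ : Map n) (X : List (Map n)) (u w : Fin n) →
            entry (σ ∷ X) u w ≡ δ (app σ u) w + entry X u w
  entry-∷ σ X u w with app σ u Fin.≟ w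
  ... | yes _ = refl
  ... | no  _ = refl

  row-sum : (X : List (Map n)) (u : Fin n) → length X ≡ sum (entry X u)
  row-sum []      u = sym (sum-replicate-zero n)
  row-sum (σ ∷ X) u = begin
      suc (length X)                            ≡⟨ cong₂ _+_ (sym (sum-δ (app σ u))) (row-sum X u) ⟩
      sum (δ (app σ u)) + sum (entry X u)       ≡⟨ sym (∑-distrib-+ (δ (app σ u)) (entry X u)) ⟩
      sum (λ w → δ (app σ u) w + entry X u w)   ≡⟨ sum-cong-≗ (λ w → sym (entry-∷ σ X u w)) ⟩
      sum (entry (σ ∷ X) u)                     ∎
    where open ≡-Reasoning

module _ {n : ℕ} where

  _≟ᴹ_ : DecidableEquality (Map n)
  _≟ᴹ_ = ≡-dec Fin._≟_

  map-ext : {σ τ : Map n} → (∀ x → app σ x ≡ app τ x) → σ ≡ τ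
  map-ext {σ} {τ} σ≗τ = trans (sym (tabulate∘lookup σ)) (trans (tabulate-cong σ≗τ) (tabulate∘lookup τ))

  infixr 9 _∘ᴹ_
  _∘ᴹ_ : Map n → Map n → Map n
  γ ∘ᴹ σ = tabulate (λ x → app γ (app σ x))

  app-∘ : ∀ γ σ x → app (γ ∘ᴹ σ) x ≡ app γ (app σ x)
  app-∘ γ σ x = lookup∘tabulate _ x

  ∘-cancelˡ : ∀ {γ σ τ} → Injective _≡_ _≡_ (app γ) → γ ∘ᴹ σ ≡ γ ∘ᴹ τ → σ ≡ τ
  ∘-cancelˡ {γ} {σ} {τ} γ-inj γσ≡γτ = map-ext λ x →
    γ-inj (trans (sym (app-∘ γ σ x)) (trans (cong (λ ρ → app ρ x) γσ≡γτ) (app-∘ γ τ x)))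

  vectors : ∀ m → List (Vec (Fin n) m)
  vectors zero    = [] ∷ []
  vectors (suc m) = map (λ (a , x) → a ∷ x) (cartesianProduct (allFin n) (vectors m))

  ∈-vectors : ∀ {m} (x : Vec (Fin n) m) → x ∈ vectors m
  ∈-vectors []      = here refl
  ∈-vectors (a ∷ x) = ∈-map⁺ (λ (a , x) → a ∷ x) (∈-cartesianProduct⁺ (∈-allFin a) (∈-vectors x))

module Automorphisms {n : ℕ} (Γ : SimpleGraph n) where

  IsAut-∘ : ∀ {γ σ} → IsAut Γ γ → IsAut Γ σ → IsAut Γ (γ ∘ᴹ σ)
  IsAut-∘ {γ} {σ} (γ-inj , γ-adj) (σ-inj , σ-adj) = ∘-inj , ∘-adj
    where
    ∘-inj : Injective _≡_ _≡_ (app (γ ∘ᴹ σ))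
    ∘-inj {x} {y} e = σ-inj (γ-inj (trans (sym (app-∘ γ σ x)) (trans e (app-∘ γ σ y))))
    ∘-adj : ∀ u w → adj Γ (app (γ ∘ᴹ σ) u) (app (γ ∘ᴹ σ) w) ≡ adj Γ u w
    ∘-adj u w = trans (cong₂ (adj Γ) (app-∘ γ σ u) (app-∘ γ σ w)) (trans (γ-adj _ _) (σ-adj u w))

  -- Being an automorphism is decidable: both conditions quantify over Fin n.
  IsAut? : Decidable (IsAut Γ)
  IsAut? σ = injective? ×-dec adjacency?
    where
    injective? : Dec (Injective _≡_ _≡_ (app σ))
    injective? = map′ (λ f {x} {y} → f x y) (λ f x y → f)
                      (all? λ x → all? λ y → (app σ x Fin.≟ app σ y) →-dec (x Fin.≟ y))
    adjacency? : Dec (∀ u w → adj Γ (app σ u) (app σ w) ≡ adj Γ u w)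
    adjacency? = all? λ u → all? λ w → adj Γ (app σ u) (app σ w) Bool.≟ adj Γ u w

  Aut : List (Map n)
  Aut = deduplicate _≟ᴹ_ (filter IsAut? (vectors n))

  Aut-unique : Unique Aut
  Aut-unique = deduplicate-! _≟ᴹ_ _

  Aut-sound : ∀ {σ} → σ ∈ Aut → IsAut Γ σ
  Aut-sound σ∈ = proj₂ (∈-filter⁻ IsAut? {xs = vectors n} (∈-deduplicate⁻ _≟ᴹ_ _ σ∈))

  Aut-complete : ∀ {σ} → IsAut Γ σ → σ ∈ Aut
  Aut-complete {σ} σ-aut = ∈-deduplicate⁺ _≟ᴹ_ (∈-filter⁺ IsAut? (∈-vectors σ) σ-aut)

difference : ∀ {a b c} → a ≡ b + c → c ≡ a ∸ b
difference {a} {b} {c} a≡b+c = trans (sym (ℕ.m+n∸m≡n b c)) (cong (_∸ b) (sym a≡b+c))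

-- n * _ is cancellable when n > 0, witnessed by an element of Fin n.
*-cancel-inhabited : ∀ {n} → Fin n → ∀ a b → n * a ≡ n * b → a ≡ b
*-cancel-inhabited {suc m} _ a b = ℕ.*-cancelˡ-≡ a b (suc m)

module Uniformity {n : ℕ} (Γ : SimpleGraph n) where
  open Automorphisms Γ
  open WithDecidableEquality (_≟ᴹ_ {n})

  sends : (u w : Fin n) → Decidable (λ (σ : Map n) → app σ u ≡ w)
  sends u w σ = app σ u Fin.≟ w

  Fiber : Fin n → Fin n → List (Map n)
  Fiber u w = filter (sends u w) Aut

  Fiber-unique : ∀ u w → Unique (Fiber u w)
  Fiber-unique u w = Unique.filter⁺ (sends u w) Aut-unique

  -- γ ∘ᴹ_ maps Fiber u w injectively into Fiber u w' when γ w = w'.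
  entry-mono : VertexTransitive Γ → ∀ u w w' → entry Aut u w ≤ entry Aut u w'
  entry-mono vt u w w' with vt w w'
  ... | γ , γ-aut , γw≡w' =
    length-injection (γ ∘ᴹ_) (∘-cancelˡ {γ = γ} (proj₁ γ-aut)) (Fiber-unique u w) (Fiber-unique u w') into
    where
    into : ∀ {σ} → σ ∈ Fiber u w → γ ∘ᴹ σ ∈ Fiber u w'
    into {σ} σ∈ with ∈-filter⁻ (sends u w) {xs = Aut} σ∈
    ... | σ∈Aut , σu≡w = ∈-filter⁺ (sends u w')
      (Aut-complete (IsAut-∘ {γ} {σ} γ-aut (Aut-sound σ∈Aut)))
      (trans (app-∘ γ σ u) (trans (cong (app γ) σu≡w) γw≡w'))

  entry-row-constant : VertexTransitive Γ → ∀ u w w' → entry Aut u w ≡ entry Aut u w'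
  entry-row-constant vt u w w' = ℕ.≤-antisym (entry-mono vt u w w') (entry-mono vt u w' w)

  length-Aut-entry : VertexTransitive Γ → ∀ u w → length Aut ≡ n * entry Aut u w
  length-Aut-entry vt u w = trans (row-sum Aut u)
    (trans (sum-cong-≗ (λ w' → entry-row-constant vt u w' w)) (sum-const n (entry Aut u w)))

  entry-stabilizer : ∀ {v s} → StabilizerOrder Γ v s → entry Aut v v ≡ s
  entry-stabilizer {v} (L , L-unique , L-sound , L-complete , L-length) =
    trans (length-≐ (Fiber-unique v v) L-unique Fiber⊆L L⊆Fiber) L-length
    where
    Fiber⊆L : Fiber v v ⊆ L
    Fiber⊆L σ∈ = let (σ∈Aut , σv≡v) = ∈-filter⁻ (sends v v) {xs = Aut} σ∈
                 in L-complete _ (Aut-sound σ∈Aut) σv≡v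
    L⊆Fiber : L ⊆ Fiber v v
    L⊆Fiber σ∈ = let (σ-aut , σv≡v) = L-sound _ σ∈
                 in ∈-filter⁺ (sends v v) (Aut-complete σ-aut) σv≡v

  module _ (vt : VertexTransitive Γ) {v : Fin n} {s : ℕ} (stab : StabilizerOrder Γ v s) where

    entry-Aut : ∀ u w → entry Aut u w ≡ s
    entry-Aut u w = trans
      (*-cancel-inhabited v _ _ (trans (sym (length-Aut-entry vt u w)) (length-Aut-entry vt v v)))
      (entry-stabilizer stab)

    length-Aut : length Aut ≡ s * n
    length-Aut = trans (length-Aut-entry vt v v) (trans (cong (n *_) (entry-stabilizer stab)) (ℕ.*-comm n s))

    Aut-uniform : UniformlyVT Γ s
    Aut-uniform = Aut , Aut-unique , All.tabulate Aut-sound , length-Aut , entry-Aut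

    complement-uniform : ∀ {k} → UniformlyVT Γ k → UniformlyVT Γ (s ∸ k)
    complement-uniform {k} (L , L-unique , L-aut , L-length , L-entry) =
      Aut ∖ L , C-unique , All.tabulate (λ σ∈ → Aut-sound (Partition.join split (inj₂ σ∈))) ,
      C-length , C-entry
      where
      split : Partition Aut L (Aut ∖ L)
      split = ∖-partition (λ σ∈ → Aut-complete (All.lookup L-aut σ∈))
      C-unique : Unique (Aut ∖ L)
      C-unique = ∖-unique L Aut-unique
      C-length : length (Aut ∖ L) ≡ (s ∸ k) * n
      C-length = trans (difference (length-partition Aut-unique L-unique C-unique split))
        (trans (cong₂ _∸_ length-Aut L-length) (sym (ℕ.*-distribʳ-∸ n s k)))
      C-entry : ∀ u w → entry (Aut ∖ L) u w ≡ s ∸ k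
      C-entry u w = trans
        (difference (length-partition (Fiber-unique u w) (Unique.filter⁺ (sends u w) L-unique)
          (Unique.filter⁺ (sends u w) C-unique) (filter-partition (sends u w) split)))
        (cong₂ _∸_ (entry-Aut u w) (L-entry u w))

open Uniformity

-- Part (a) is Aut itself; part (b) applies complementation in both
-- directions, using s - (s - k) = k for k ≤ s.
proposition6p2 : ∀ {n} (Γ : SimpleGraph n) (v : Fin n) (s : ℕ) →
    VertexTransitive Γ → StabilizerOrder Γ v s →
    UniformlyVT Γ s ×
    (∀ k → 1 ≤ k → k ≤ s ∸ 1 → (UniformlyVT Γ k ⇔ UniformlyVT Γ (s ∸ k)))
proposition6p2 Γ v s vt stab =
  Aut-uniform Γ vt stab ,
  λ k _ k≤s∸1 → mk⇔ (complement-uniform Γ vt stab)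
    (λ U → subst (UniformlyVT Γ) (ℕ.m∸[m∸n]≡n (k≤s k≤s∸1)) (complement-uniform Γ vt stab U))
  where
  k≤s : ∀ {k} → k ≤ s ∸ 1 → k ≤ s
  k≤s k≤s∸1 = ℕ.≤-trans k≤s∸1 (ℕ.m∸n≤m s 1)
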